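{- Let $G=(V,E)$ be a graph. Every minimal edge cut dominating set of $G$ is a maximal edge cut irredundant set of $G$.
   Context: Two distinct edges are adjacent if they share a vertex. A set $F\subseteq E$ is an edge dominating set if every edge not in $F$ is adjacent to some edge of $F$. Say $F\subseteq E$ is an edge cut if the spanning subgraph $(V,E\setminus F)$ is disconnected. An edge cut dominating set is an edge dominating set that is an edge cut. An edge cut dominating set $F$ is minimal if for every $e\in F$, either $F\setminus\{e\}$ is not an edge dominating set or $F\setminus\{e\}$ is not an edge cut. For $F\subseteq E$, an edge $e\in F$ has a private neighbor with respect to $F$ if either $e$ is adjacent to no other edge of $F$, or there exists $e'\notin F$ adjacent to $e$ and to no other edge of $F$; $e$ is then called irredundant (in $F$). A set $F\subseteq E$ is edge cut irredundant if for every $e\in F$, either $e$ is irredundant in $F$ or $F\setminus\{e\}$ is not an edge cut. An edge cut irredundant set $F$ is maximal if $F\cup\{e\}$ is not edge cut irredundant for every $e\in E\setminus F$. -}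

module Defs where

open import Data.Nat using (ℕ)
open import Data.Fin using (Fin)
open import Data.Fin.Subset using (Subset; _∈_; _∉_; _∪_; _-_; ⁅_⁆)
open import Data.Product using (Σ; ∃; _×_; _,_; proj₁; proj₂)
open import Data.Sum using (_⊎_)
open import Relation.Nullary using (¬_)
open import Relation.Binary.PropositionalEquality using (_≡_; _≢_)

record Graph : Set where
  field
    n m     : ℕ
    end₁    : Fin m → Fin n
    end₂    : Fin m → Fin n
    noLoop  : ∀ e → end₁ e ≢ end₂ e
    noMulti : ∀ e f →
              ((end₁ e ≡ end₁ f × end₂ e ≡ end₂ f) ⊎ (end₁ e ≡ end₂ f × end₂ e ≡ end₁ f)) →
              e ≡ f

module _ (G : Graph) where
  open Graph G

  Vertex : Set
  Vertex = Fin n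

  Edge : Set
  Edge = Fin m

  EdgeSet : Set
  EdgeSet = Subset m

  IncidentTo : Vertex → Edge → Set
  IncidentTo v e = (v ≡ end₁ e) ⊎ (v ≡ end₂ e)

  Adjacent : Edge → Edge → Set
  Adjacent e f = e ≢ f × Σ Vertex (λ v → IncidentTo v e × IncidentTo v f)

  IsEdgeDominating : EdgeSet → Set
  IsEdgeDominating F = ∀ e → e ∉ F → Σ Edge (λ f → f ∈ F × Adjacent e f)

  -- reachability in the spanning subgraph (V, E \ F)
  data Reach (F : EdgeSet) : Vertex → Vertex → Set where
    here : ∀ {u} → Reach F u u
    step : ∀ {u v} (e : Edge) → e ∉ F →
           ((u ≡ end₁ e × v ≡ end₂ e) ⊎ (u ≡ end₂ e × v ≡ end₁ e)) →
           ∀ {w} → Reach F v w → Reach F u w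

  IsEdgeCut : EdgeSet → Set
  IsEdgeCut F = Σ Vertex (λ u → Σ Vertex (λ v → ¬ Reach F u v))

  IsEdgeCutDominating : EdgeSet → Set
  IsEdgeCutDominating F = IsEdgeDominating F × IsEdgeCut F

  IsMinimalEdgeCutDominating : EdgeSet → Set
  IsMinimalEdgeCutDominating F =
    IsEdgeCutDominating F ×
    (∀ e → e ∈ F → ¬ IsEdgeDominating (F - e) ⊎ ¬ IsEdgeCut (F - e))

  Irredundant : EdgeSet → Edge → Set
  Irredundant F e =
    (∀ f → f ∈ F → ¬ Adjacent e f)
    ⊎ Σ Edge (λ e' → e' ∉ F × Adjacent e e' ×
                     (∀ f → f ∈ F → f ≢ e → ¬ Adjacent e' f))

  IsEdgeCutIrredundant : EdgeSet → Set
  IsEdgeCutIrredundant F = ∀ e → e ∈ F → Irredundant F e ⊎ ¬ IsEdgeCut (F - e)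

  IsMaximalEdgeCutIrredundant : EdgeSet → Set
  IsMaximalEdgeCutIrredundant F =
    IsEdgeCutIrredundant F × (∀ e → e ∉ F → ¬ IsEdgeCutIrredundant (F ∪ ⁅ e ⁆))

module Submission where

open import Defs
open import Data.Fin using (_≟_)
open import Data.Fin.Subset using (_∈_; _∉_; _⊆_; _∪_; _-_; ⁅_⁆)
open import Data.Fin.Subset.Properties using (_∈?_; x∈p∧x≢y⇒x∈p-y; p⊆p∪q; q⊆p∪q; x∈⁅x⁆)
open import Data.Fin.Properties using (any?; ¬∀⟶∃¬)
open import Data.Product using (Σ; ∃; _×_; _,_)
open import Data.Sum using (inj₁; inj₂)
open import Data.Empty using (⊥-elim)
open import Relation.Nullary using (¬_; Dec; yes; no)
open import Relation.Nullary.Decidable using (_×-dec_; _⊎-dec_; _→-dec_; ¬?; map′)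
open import Relation.Binary.PropositionalEquality using (refl; sym)

-- If removing e from a minimal edge cut dominating set F keeps the cut, it
-- destroys domination, so some edge e' is dominated only by e: either e' = e
-- (then e has no neighbour in F) or e' is a private neighbour of e.
-- Conversely, an edge e ∉ F cannot be added: (F ∪ {e}) − e = F is still a
-- cut, e is dominated by F, and every edge outside F ∪ {e} has a neighbour in
-- F other than e, so e has no private neighbour.

module _ (G : Graph) where
  open Graph G

  DominatedBy : EdgeSet G → Edge G → Set
  DominatedBy S e = Σ (Edge G) (λ f → f ∈ S × Adjacent G e f)

  Adjacent-sym : ∀ {e f} → Adjacent G e f → Adjacent G f e
  Adjacent-sym (e≢f , v , v∼e , v∼f) = (λ f≡e → e≢f (sym f≡e)) , v , v∼f , v∼e

  incident? : ∀ v e → Dec (IncidentTo G v e)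
  incident? v e = (v ≟ end₁ e) ⊎-dec (v ≟ end₂ e)

  adjacent? : ∀ e f → Dec (Adjacent G e f)
  adjacent? e f with e ≟ f
  ... | yes e≡f = no (λ (e≢f , _) → e≢f e≡f)
  ... | no e≢f  = map′ (e≢f ,_) (λ (_ , shared) → shared)
                       (any? (λ v → incident? v e ×-dec incident? v f))

  dominatedBy? : ∀ S e → Dec (DominatedBy S e)
  dominatedBy? S e = any? (λ f → (f ∈? S) ×-dec adjacent? e f)

  ¬dominating⇒∃undominated : ∀ {S} → ¬ IsEdgeDominating G S →
                             ∃ λ e → e ∉ S × ¬ DominatedBy S e
  ¬dominating⇒∃undominated {S} ¬dom
    with ¬∀⟶∃¬ m _ (λ e → ¬? (e ∈? S) →-dec dominatedBy? S e) ¬dom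
  ... | e , ¬[e∉S⇒dominated] with e ∈? S
  ...   | yes e∈S = ⊥-elim (¬[e∉S⇒dominated] (λ e∉S → ⊥-elim (e∉S e∈S)))
  ...   | no  e∉S = e , e∉S , λ dominated → ¬[e∉S⇒dominated] (λ _ → dominated)

  ¬dominating-minus⇒irredundant : ∀ {F e} → IsEdgeDominating G F →
                                  ¬ IsEdgeDominating G (F - e) → Irredundant G F e
  ¬dominating-minus⇒irredundant {F} {e} dom ¬dom with ¬dominating⇒∃undominated ¬dom
  ... | e' , e'∉F-e , undominated with e' ≟ e
  ...   | yes refl = inj₁ λ f f∈F e∼f@(e≢f , _) →
            undominated (f , x∈p∧x≢y⇒x∈p-y f∈F (λ f≡e → e≢f (sym f≡e)) , e∼f)
  ...   | no e'≢e = inj₂ (e' , e'∉F , Adjacent-sym e'∼e ,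
            λ f f∈F f≢e e'∼f → undominated (f , x∈p∧x≢y⇒x∈p-y f∈F f≢e , e'∼f))
    where
    e'∉F : e' ∉ F
    e'∉F e'∈F = e'∉F-e (x∈p∧x≢y⇒x∈p-y e'∈F e'≢e)

    e'∼e : Adjacent G e' e
    e'∼e with dom e' e'∉F
    ... | f , f∈F , e'∼f with f ≟ e
    ...   | yes refl = e'∼f
    ...   | no f≢e   = ⊥-elim (undominated (f , x∈p∧x≢y⇒x∈p-y f∈F f≢e , e'∼f))

  minimal⇒edgeCutIrredundant : ∀ {F} → IsMinimalEdgeCutDominating G F →
                               IsEdgeCutIrredundant G F
  minimal⇒edgeCutIrredundant ((dom , _) , minimal) e e∈F with minimal e e∈F
  ... | inj₁ ¬dom = inj₁ (¬dominating-minus⇒irredundant dom ¬dom)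
  ... | inj₂ ¬cut = inj₂ ¬cut

  Reach-antimono : ∀ {A B} → A ⊆ B → ∀ {u v} → Reach G B u v → Reach G A u v
  Reach-antimono A⊆B here                = here
  Reach-antimono A⊆B (step e e∉B uv r) = step e (λ e∈A → e∉B (A⊆B e∈A)) uv (Reach-antimono A⊆B r)

  edgeCut-mono : ∀ {A B} → A ⊆ B → IsEdgeCut G A → IsEdgeCut G B
  edgeCut-mono A⊆B (u , v , ¬reach) = u , v , λ r → ¬reach (Reach-antimono A⊆B r)

  ⊆-∪⁅⁆-minus : ∀ {F : EdgeSet G} {e} → e ∉ F → F ⊆ F ∪ ⁅ e ⁆ - e
  ⊆-∪⁅⁆-minus {F} {e} e∉F {f} f∈F =
    x∈p∧x≢y⇒x∈p-y (p⊆p∪q ⁅ e ⁆ f∈F) (λ { refl → e∉F f∈F })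

  dominating⇒¬irredundant-insert : ∀ {F e} → IsEdgeDominating G F → e ∉ F →
                                   ¬ Irredundant G (F ∪ ⁅ e ⁆) e
  dominating⇒¬irredundant-insert {F} {e} dom e∉F (inj₁ isolated)
    with dom e e∉F
  ... | f , f∈F , e∼f = isolated f (p⊆p∪q ⁅ e ⁆ f∈F) e∼f
  dominating⇒¬irredundant-insert {F} {e} dom e∉F (inj₂ (e' , e'∉F∪e , _ , isPrivate))
    with dom e' (λ e'∈F → e'∉F∪e (p⊆p∪q ⁅ e ⁆ e'∈F))
  ... | f , f∈F , e'∼f = isPrivate f (p⊆p∪q ⁅ e ⁆ f∈F) (λ { refl → e∉F f∈F }) e'∼f

  dominatingCut⇒¬edgeCutIrredundant-insert : ∀ {F e} → IsEdgeCutDominating G F → e ∉ F →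
                                             ¬ IsEdgeCutIrredundant G (F ∪ ⁅ e ⁆)
  dominatingCut⇒¬edgeCutIrredundant-insert {F} {e} (dom , cut) e∉F irr
    with irr e (q⊆p∪q F ⁅ e ⁆ (x∈⁅x⁆ e))
  ... | inj₁ irredundant = dominating⇒¬irredundant-insert dom e∉F irredundant
  ... | inj₂ ¬cut        = ¬cut (edgeCut-mono (⊆-∪⁅⁆-minus e∉F) cut)

mainTheorem4 : (G : Graph) (F : EdgeSet G) →
    IsMinimalEdgeCutDominating G F → IsMaximalEdgeCutIrredundant G F
mainTheorem4 G F minimal@(dominatingCut , _) =
  minimal⇒edgeCutIrredundant G minimal ,
  λ e → dominatingCut⇒¬edgeCutIrredundant-insert G dominatingCut
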